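{- Let $G$ be a finite group (written multiplicatively) and let $H=\{H_1,\dots,H_m\}$ be a collection of distinct subgroups of $G$ such that $G=H_iH_j$ for all $1\le i\ne j\le m$. Then: (i) $H$ is a non-disjoint $(|G|,m,|H_1|,\dots,|H_m|)$-GPSEDF with $\lambda_{i,j}=|H_i\cap H_j|$ for all $i\ne j$. (ii) For any $i$, replacing $H_i$ in $H$ by a union of $\mu_i$ distinct left cosets $gH_i$ of $H_i$ yields a non-disjoint $(|G|,m,|H_1|,\dots,\mu_i|H_i|,\dots,|H_m|)$-GPSEDF.
   Context: $H_iH_j=\{xy:x\in H_i,y\in H_j\}$. For subsets $A,B$ of a multiplicatively written group $G$, $\Delta(A,B)$ denotes the multiset $\{ab^{ -1}:a\in A,b\in B\}$ (one entry per pair). For $\lambda\in\mathbb{N}\cup\{0\}$, $\lambda G$ is the multiset containing every element of $G$ exactly $\lambda$ times. Let $|G|=v$. A family of sets $\{A_1,\dots,A_m\}$ in $G$ with $|A_i|=k_i$ is a non-disjoint $(v,m,k_1,\dots,k_m)$-GPSEDF if $\Delta(A_i,A_j)=\lambda_{i,j}G$ with $\lambda_{i,j}=k_ik_j/v$ for all $1\le i\ne j\le m$. -}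

module Defs where

open import Level using (0ℓ)
open import Data.Nat using (ℕ; _*_)
open import Data.Fin using (Fin; _≟_)
open import Data.Fin.Properties using (any?)
open import Data.List using (List; length; filter; cartesianProduct)
open import Data.List.Membership.Propositional using (_∈_)
open import Data.List.Relation.Unary.Unique.Propositional using (Unique)
open import Data.Product using (Σ; ∃; _×_; _,_; proj₁; proj₂)
open import Relation.Nullary using (¬_; Dec; yes; no; does)
open import Relation.Nullary.Decidable using (_×-dec_)
open import Relation.Unary using (Pred; Decidable)
open import Relation.Binary.PropositionalEquality using (_≡_; _≢_)
open import Relation.Binary using (DecidableEquality)
open import Algebra.Structures using (IsGroup)
open import Data.Bool using (if_then_else_)

record FinGroup : Set₁ where
  field
    Carrier  : Set
    _∙_      : Carrier → Carrier → Carrier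
    ε        : Carrier
    _⁻¹      : Carrier → Carrier
    isGroup  : IsGroup _≡_ _∙_ ε _⁻¹
    _≟G_     : DecidableEquality Carrier
    elems    : List Carrier
    complete : ∀ x → x ∈ elems
    unique   : Unique elems
  infixl 7 _∙_
  infix 8 _⁻¹

  order : ℕ
  order = length elems

module _ (G : FinGroup) where
  open FinGroup G

  record Subset : Set₁ where
    field
      mem  : Pred Carrier 0ℓ
      mem? : Decidable mem
  open Subset public

  card : Subset → ℕ
  card A = length (filter (mem? A) elems)

  _∩_ : Subset → Subset → Subset
  A ∩ B = record { mem = λ x → mem A x × mem B x
                 ; mem? = λ x → mem? A x ×-dec mem? B x }

  -- multiplicity of g in the multiset Δ(A,B) = { a b⁻¹ : a ∈ A, b ∈ B }
  Δcount : Subset → Subset → Carrier → ℕ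
  Δcount A B g = length (filter P? (cartesianProduct elems elems))
    where
    P : Carrier × Carrier → Set
    P (a , b) = (mem A a × mem B b) × (a ∙ b ⁻¹ ≡ g)
    P? : Decidable P
    P? (a , b) = (mem? A a ×-dec mem? B b) ×-dec ((a ∙ b ⁻¹) ≟G g)

  ΔIs : Subset → Subset → ℕ → Set
  ΔIs A B λ′ = ∀ g → Δcount A B g ≡ λ′

  -- non-disjoint (v, m, k_1, ..., k_m)-GPSEDF with v = |G|, k_i = |A_i|:
  -- for all i ≠ j, Δ(A_i,A_j) = λ_{ij} G with λ_{ij} = k_i k_j / v (a natural number)
  IsGPSEDF : (m : ℕ) → (Fin m → Subset) → Set
  IsGPSEDF m A = ∀ i j → i ≢ j →
    Σ ℕ λ λij → (λij * order ≡ card (A i) * card (A j)) × ΔIs (A i) (A j) λij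

  record IsSubgroup (H : Subset) : Set where
    field
      ε∈  : mem H ε
      ∙∈  : ∀ {x y} → mem H x → mem H y → mem H (x ∙ y)
      ⁻¹∈ : ∀ {x} → mem H x → mem H (x ⁻¹)

  SameSet : Subset → Subset → Set
  SameSet A B = ∀ x → (mem A x → mem B x) × (mem B x → mem A x)

  ProductIsG : Subset → Subset → Set
  ProductIsG H K = ∀ g → ∃ λ x → ∃ λ y → mem H x × mem K y × (g ≡ x ∙ y)

  leftCoset : Carrier → Subset → Subset
  leftCoset g H = record { mem = λ x → mem H (g ⁻¹ ∙ x) ; mem? = λ x → mem? H (g ⁻¹ ∙ x) }

  unionCosets : (μ : ℕ) → (Fin μ → Carrier) → Subset → Subset
  unionCosets μ r H = record
    { mem  = λ x → ∃ λ a → mem (leftCoset (r a) H) x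
    ; mem? = λ x → any? (λ a → mem? (leftCoset (r a) H) x) }

  DistinctCosets : (μ : ℕ) → (Fin μ → Carrier) → Subset → Set
  DistinctCosets μ r H = ∀ a b → a ≢ b → ¬ SameSet (leftCoset (r a) H) (leftCoset (r b) H)

  replaceAt : {m : ℕ} → (Fin m → Subset) → Fin m → Subset → Fin m → Subset
  replaceAt A i B k = if does (k ≟ i) then B else A k

-- Write the number of representations g = a b⁻¹ (a ∈ A, b ∈ B) as Σₐ 𝟙_A(a) 𝟙_B(g⁻¹a).
-- Translating one set by c only moves g: Δ(cA, B) counts g as often as Δ(A, B) counts c⁻¹g,
-- and Δ(A, cB) counts g as often as Δ(A, B) counts gc. For subgroups H, K and g = xy with
-- x ∈ H, y ∈ K we have xH = H and yK = K, so g is counted exactly as often as ε, namely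
-- |H ∩ K| times. Distinct left cosets of a subgroup are disjoint, so the counts for their union
-- are sums of μ translated copies of a constant count. Summing any constant count λ over all g
-- gives λ|G| = |A||B|.
module Submission where

open import Defs
open import Level using (0ℓ)
open import Algebra.Bundles using (Group)
open import Algebra.Structures using (IsGroup)
import Algebra.Properties.Group as GroupProperties
open import Data.Bool using (true; false; if_then_else_)
open import Data.Empty using (⊥-elim)
open import Data.Fin using (Fin) renaming (_≟_ to _≟ᶠ_)
open import Data.List using (List; []; _∷_; _++_; map; length; filter; cartesianProduct; allFin)
open import Data.List.Membership.Propositional using (_∈_)
open import Data.List.Membership.Propositional.Properties using (∈-allFin)
open import Data.List.Properties using (length-tabulate)
open import Data.List.Relation.Unary.All using (All; []; _∷_)
open import Data.List.Relation.Unary.AllPairs using (_∷_)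
open import Data.List.Relation.Unary.Any using (here; there)
open import Data.List.Relation.Unary.Unique.Propositional using (Unique)
open import Data.List.Relation.Unary.Unique.Propositional.Properties using (allFin⁺)
open import Data.Nat using (ℕ; suc; _+_; _*_)
open import Data.Nat.Properties
  using (+-assoc; +-identityʳ; *-zeroʳ; *-identityˡ; *-identityʳ; *-assoc; *-comm;
         *-distribˡ-+; *-distribʳ-+; +-commutativeSemigroup)
open import Algebra.Properties.CommutativeSemigroup +-commutativeSemigroup using (interchange)
open import Data.Product using (Σ; ∃; _×_; _,_; proj₁; proj₂)
open import Relation.Binary using (DecidableEquality)
open import Relation.Binary.PropositionalEquality
open import Relation.Nullary using (¬_; Dec; yes; no; does)
open import Relation.Nullary.Decidable using (_×-dec_)
open import Relation.Unary using (Pred; Decidable)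

∑ : {A : Set} → List A → (A → ℕ) → ℕ
∑ []       f = 0
∑ (x ∷ xs) f = f x + ∑ xs f

infix 5 ∑
syntax ∑ xs (λ x → e) = ∑[ x ← xs ] e

𝟙 : {P : Set} → Dec P → ℕ
𝟙 d = if does d then 1 else 0

𝟙-× : {P Q : Set} (p : Dec P) (q : Dec Q) → 𝟙 (p ×-dec q) ≡ 𝟙 p * 𝟙 q
𝟙-× (yes _) (yes _) = refl
𝟙-× (yes _) (no _)  = refl
𝟙-× (no _)  _       = refl

𝟙-cong : {P Q : Set} → (P → Q) → (Q → P) → (p : Dec P) (q : Dec Q) → 𝟙 p ≡ 𝟙 q
𝟙-cong P→Q Q→P (yes p) (yes q) = refl
𝟙-cong P→Q Q→P (yes p) (no ¬q) = ⊥-elim (¬q (P→Q p))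
𝟙-cong P→Q Q→P (no ¬p) (yes q) = ⊥-elim (¬p (Q→P q))
𝟙-cong P→Q Q→P (no ¬p) (no ¬q) = refl

𝟙-no : {P : Set} → ¬ P → (p : Dec P) → 𝟙 p ≡ 0
𝟙-no ¬p (yes p) = ⊥-elim (¬p p)
𝟙-no ¬p (no _)  = refl

module _ {A : Set} where

  ∑-cong : ∀ xs {f g : A → ℕ} → f ≗ g → ∑ xs f ≡ ∑ xs g
  ∑-cong []       f≗g = refl
  ∑-cong (x ∷ xs) f≗g = cong₂ _+_ (f≗g x) (∑-cong xs f≗g)

  ∑-const : ∀ xs c → ∑[ x ← xs ] c ≡ length {A = A} xs * c
  ∑-const []       c = refl
  ∑-const (x ∷ xs) c = cong (c +_) (∑-const xs c)

  ∑-const-cong : ∀ xs {f : A → ℕ} {c} → (∀ x → f x ≡ c) → ∑ xs f ≡ length xs * c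
  ∑-const-cong xs {c = c} f≡c = trans (∑-cong xs f≡c) (∑-const xs c)

  ∑-zero : ∀ xs → ∑[ x ← xs ] 0 ≡ 0
  ∑-zero xs = trans (∑-const xs 0) (*-zeroʳ (length {A = A} xs))

  ∑-distrib-+ : ∀ xs (f g : A → ℕ) → ∑[ x ← xs ] (f x + g x) ≡ ∑ xs f + ∑ xs g
  ∑-distrib-+ []       f g = refl
  ∑-distrib-+ (x ∷ xs) f g =
    trans (cong (f x + g x +_) (∑-distrib-+ xs f g)) (interchange (f x) (g x) (∑ xs f) (∑ xs g))

  ∑-distribˡ : ∀ xs c (f : A → ℕ) → ∑[ x ← xs ] (c * f x) ≡ c * ∑ xs f
  ∑-distribˡ []       c f = sym (*-zeroʳ c)
  ∑-distribˡ (x ∷ xs) c f =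
    trans (cong (c * f x +_) (∑-distribˡ xs c f)) (sym (*-distribˡ-+ c (f x) (∑ xs f)))

  ∑-distribʳ : ∀ xs c (f : A → ℕ) → ∑[ x ← xs ] (f x * c) ≡ ∑ xs f * c
  ∑-distribʳ []       c f = refl
  ∑-distribʳ (x ∷ xs) c f =
    trans (cong (f x * c +_) (∑-distribʳ xs c f)) (sym (*-distribʳ-+ c (f x) (∑ xs f)))

  ∑-++ : ∀ xs ys (f : A → ℕ) → ∑ (xs ++ ys) f ≡ ∑ xs f + ∑ ys f
  ∑-++ []       ys f = refl
  ∑-++ (x ∷ xs) ys f = trans (cong (f x +_) (∑-++ xs ys f)) (sym (+-assoc (f x) _ _))

  length-filter≡∑ : ∀ {P : Pred A 0ℓ} (P? : Decidable P) xs →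
    length (filter P? xs) ≡ ∑[ x ← xs ] 𝟙 (P? x)
  length-filter≡∑ P? []       = refl
  length-filter≡∑ P? (x ∷ xs) with does (P? x)
  ... | true  = cong suc (length-filter≡∑ P? xs)
  ... | false = length-filter≡∑ P? xs

∑-map : {A B : Set} (h : A → B) (xs : List A) (f : B → ℕ) → ∑ (map h xs) f ≡ ∑[ x ← xs ] f (h x)
∑-map h []       f = refl
∑-map h (x ∷ xs) f = cong (f (h x) +_) (∑-map h xs f)

module _ {A B : Set} where

  ∑-comm : ∀ xs ys (f : A → B → ℕ) → ∑[ x ← xs ] ∑[ y ← ys ] f x y ≡ ∑[ y ← ys ] ∑[ x ← xs ] f x y
  ∑-comm []       ys f = sym (∑-zero ys)
  ∑-comm (x ∷ xs) ys f =
    trans (cong (∑ ys (f x) +_) (∑-comm xs ys f)) (sym (∑-distrib-+ ys (f x) _))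

  ∑-cartesianProduct : ∀ xs ys (f : A × B → ℕ) →
    ∑ (cartesianProduct xs ys) f ≡ ∑[ x ← xs ] ∑[ y ← ys ] f (x , y)
  ∑-cartesianProduct []       ys f = refl
  ∑-cartesianProduct (x ∷ xs) ys f =
    trans (∑-++ (map (x ,_) ys) _ f) (cong₂ _+_ (∑-map (x ,_) ys f) (∑-cartesianProduct xs ys f))

module _ {A : Set} (_≟_ : DecidableEquality A) where

  ∑-absent : ∀ {c} ys (f : A → ℕ) → All (c ≢_) ys → ∑[ x ← ys ] f x * 𝟙 (x ≟ c) ≡ 0
  ∑-absent []       f []           = refl
  ∑-absent {c} (y ∷ ys) f (c≢y ∷ c∉ys) with y ≟ c
  ... | yes refl = ⊥-elim (c≢y refl)
  ... | no _     = cong₂ _+_ (*-zeroʳ (f y)) (∑-absent ys f c∉ys)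

  ∑-delta : ∀ {c xs} (f : A → ℕ) → Unique xs → c ∈ xs → ∑[ x ← xs ] f x * 𝟙 (x ≟ c) ≡ f c
  ∑-delta {c} {y ∷ ys} f (y∉ys ∷ _) c∈xs with y ≟ c
  ∑-delta {c} {y ∷ ys} f (y∉ys ∷ _) _ | yes refl =
    trans (cong₂ _+_ (*-identityʳ (f y)) (∑-absent ys f y∉ys)) (+-identityʳ (f y))
  ∑-delta {c} {y ∷ ys} f _ (here c≡y) | no y≢c = ⊥-elim (y≢c (sym c≡y))
  ∑-delta {c} {y ∷ ys} f (_ ∷ u) (there c∈ys) | no _ =
    cong₂ _+_ (*-zeroʳ (f y)) (∑-delta f u c∈ys)

module Enumeration {A : Set} (_≟_ : DecidableEquality A) {xs : List A}
                   (complete : ∀ x → x ∈ xs) (unique : Unique xs) where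

  𝟙-∃! : {P : Pred A 0ℓ} (P? : Decidable P) → (∀ {a b} → P a → P b → a ≡ b) →
         (d : Dec (∃ P)) → 𝟙 d ≡ ∑[ x ← xs ] 𝟙 (P? x)
  𝟙-∃! P? P-unique (yes (a , pa)) = sym (begin
    ∑[ x ← xs ] 𝟙 (P? x)             ≡⟨ ∑-cong xs is-a ⟩
    ∑[ x ← xs ] 1 * 𝟙 (x ≟ a)        ≡⟨ ∑-delta _≟_ (λ _ → 1) unique (complete a) ⟩
    1                                ∎)
    where
    open ≡-Reasoning
    is-a : ∀ x → 𝟙 (P? x) ≡ 1 * 𝟙 (x ≟ a)
    is-a x = trans (𝟙-cong (λ px → P-unique px pa) (λ { refl → pa }) (P? x) (x ≟ a))
                   (sym (*-identityˡ _))
  𝟙-∃! P? P-unique (no ∄P) =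
    sym (trans (∑-cong xs (λ x → 𝟙-no (λ px → ∄P (x , px)) (P? x))) (∑-zero xs))

  ∑-reindex : (φ ψ : A → A) → (∀ y → φ (ψ y) ≡ y) → (∀ x → ψ (φ x) ≡ x) →
              ∀ f → ∑[ x ← xs ] f (φ x) ≡ ∑ xs f
  ∑-reindex φ ψ φψ ψφ f = begin
    ∑[ x ← xs ] f (φ x)
      ≡⟨ ∑-cong xs (λ x → sym (∑-delta _≟_ f unique (complete (φ x)))) ⟩
    ∑[ x ← xs ] ∑[ y ← xs ] f y * 𝟙 (y ≟ φ x)
      ≡⟨ ∑-comm xs xs _ ⟩
    ∑[ y ← xs ] ∑[ x ← xs ] f y * 𝟙 (y ≟ φ x)
      ≡⟨ ∑-cong xs (λ y → ∑-distribˡ xs (f y) _) ⟩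
    ∑[ y ← xs ] f y * (∑[ x ← xs ] 𝟙 (y ≟ φ x))
      ≡⟨ ∑-cong xs (λ y → cong (f y *_) (sym (hit-once y))) ⟩
    ∑[ y ← xs ] f y * 1
      ≡⟨ ∑-cong xs (λ y → *-identityʳ (f y)) ⟩
    ∑ xs f ∎
    where
    open ≡-Reasoning
    φ-injective : ∀ {a b} → φ a ≡ φ b → a ≡ b
    φ-injective {a} {b} e = trans (sym (ψφ a)) (trans (cong ψ e) (ψφ b))
    hit-once : ∀ y → 1 ≡ ∑[ x ← xs ] 𝟙 (y ≟ φ x)
    hit-once y = 𝟙-∃! (λ x → y ≟ φ x) (λ e e′ → φ-injective (trans (sym e) e′))
                      (yes (ψ y , sym (φψ y)))

module _ (G : FinGroup) where
  open FinGroup G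

  private
    group : Group 0ℓ 0ℓ
    group = record
      { Carrier = Carrier ; _≈_ = _≡_ ; _∙_ = _∙_ ; ε = ε ; _⁻¹ = _⁻¹ ; isGroup = isGroup }

  open IsGroup isGroup using (assoc; identityˡ; _\\_; _//_)
  open GroupProperties group
    using (⁻¹-anti-homo-∙; ⁻¹-involutive; \\-leftDividesˡ; \\-leftDividesʳ;
           //-rightDividesˡ; y≈x\\z; x≈z//y; ε⁻¹≈ε)
  open Enumeration _≟G_ complete unique using (∑-reindex)

  //≡⇒≡\\ : ∀ {a b g} → a // b ≡ g → b ≡ g \\ a
  //≡⇒≡\\ {a} {b} {g} a//b≡g =
    y≈x\\z g b a (trans (cong (_∙ b) (sym a//b≡g)) (//-rightDividesˡ b a))

  ≡\\⇒//≡ : ∀ {a b g} → b ≡ g \\ a → a // b ≡ g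
  ≡\\⇒//≡ {a} {b} {g} b≡g\\a =
    sym (x≈z//y g b a (trans (cong (g ∙_) b≡g\\a) (\\-leftDividesˡ g a)))

  [x\\y]\\z≡y\\[x∙z] : ∀ x y z → (x \\ y) \\ z ≡ y \\ (x ∙ z)
  [x\\y]\\z≡y\\[x∙z] x y z = begin
    (x ⁻¹ ∙ y) ⁻¹ ∙ z       ≡⟨ cong (_∙ z) (⁻¹-anti-homo-∙ (x ⁻¹) y) ⟩
    (y ⁻¹ ∙ x ⁻¹ ⁻¹) ∙ z    ≡⟨ cong (λ t → (y ⁻¹ ∙ t) ∙ z) (⁻¹-involutive x) ⟩
    (y ⁻¹ ∙ x) ∙ z          ≡⟨ assoc (y ⁻¹) x z ⟩
    y ⁻¹ ∙ (x ∙ z)          ∎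
    where open ≡-Reasoning

  [x∙y]\\z≡y\\[x\\z] : ∀ x y z → (x ∙ y) \\ z ≡ y \\ (x \\ z)
  [x∙y]\\z≡y\\[x\\z] x y z =
    trans (cong (_∙ z) (⁻¹-anti-homo-∙ x y)) (assoc (y ⁻¹) (x ⁻¹) z)

  𝟙[_] : Subset G → Carrier → ℕ
  𝟙[ A ] x = 𝟙 (mem? A x)

  𝟙[]-cong : ∀ {A B} → SameSet G A B → ∀ x → 𝟙[ A ] x ≡ 𝟙[ B ] x
  𝟙[]-cong {A} {B} A≈B x = 𝟙-cong (proj₁ (A≈B x)) (proj₂ (A≈B x)) (mem? A x) (mem? B x)

  card≡∑ : ∀ A → card G A ≡ ∑ elems 𝟙[ A ]
  card≡∑ A = length-filter≡∑ (mem? A) elems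

  Δcount≡∑ : ∀ A B g → Δcount G A B g ≡ ∑[ a ← elems ] 𝟙[ A ] a * 𝟙[ B ] (g \\ a)
  Δcount≡∑ A B g =
    trans (length-filter≡∑ _ (cartesianProduct elems elems))
          (trans (∑-cartesianProduct elems elems _) (∑-cong elems row))
    where
    open ≡-Reasoning
    row : ∀ a → ∑[ b ← elems ] 𝟙 ((mem? A a ×-dec mem? B b) ×-dec ((a // b) ≟G g))
                ≡ 𝟙[ A ] a * 𝟙[ B ] (g \\ a)
    row a = begin
      ∑[ b ← elems ] 𝟙 ((mem? A a ×-dec mem? B b) ×-dec ((a // b) ≟G g))
        ≡⟨ ∑-cong elems entry ⟩
      ∑[ b ← elems ] 𝟙[ A ] a * (𝟙[ B ] b * 𝟙 (b ≟G (g \\ a)))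
        ≡⟨ ∑-distribˡ elems (𝟙[ A ] a) _ ⟩
      𝟙[ A ] a * (∑[ b ← elems ] 𝟙[ B ] b * 𝟙 (b ≟G (g \\ a)))
        ≡⟨ cong (𝟙[ A ] a *_) (∑-delta _≟G_ 𝟙[ B ] unique (complete (g \\ a))) ⟩
      𝟙[ A ] a * 𝟙[ B ] (g \\ a) ∎
      where
      entry : ∀ b → 𝟙 ((mem? A a ×-dec mem? B b) ×-dec ((a // b) ≟G g))
                    ≡ 𝟙[ A ] a * (𝟙[ B ] b * 𝟙 (b ≟G (g \\ a)))
      entry b = begin
        𝟙 ((mem? A a ×-dec mem? B b) ×-dec ((a // b) ≟G g))
          ≡⟨ 𝟙-× (mem? A a ×-dec mem? B b) ((a // b) ≟G g) ⟩
        𝟙 (mem? A a ×-dec mem? B b) * 𝟙 ((a // b) ≟G g)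
          ≡⟨ cong₂ _*_ (𝟙-× (mem? A a) (mem? B b))
                       (𝟙-cong //≡⇒≡\\ ≡\\⇒//≡ ((a // b) ≟G g) (b ≟G (g \\ a))) ⟩
        𝟙[ A ] a * 𝟙[ B ] b * 𝟙 (b ≟G (g \\ a))
          ≡⟨ *-assoc (𝟙[ A ] a) _ _ ⟩
        𝟙[ A ] a * (𝟙[ B ] b * 𝟙 (b ≟G (g \\ a))) ∎

  ∑-Δcount : ∀ A B → ∑[ g ← elems ] Δcount G A B g ≡ card G A * card G B
  ∑-Δcount A B = begin
    ∑[ g ← elems ] Δcount G A B g
      ≡⟨ ∑-cong elems (Δcount≡∑ A B) ⟩
    ∑[ g ← elems ] ∑[ a ← elems ] 𝟙[ A ] a * 𝟙[ B ] (g \\ a)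
      ≡⟨ ∑-comm elems elems _ ⟩
    ∑[ a ← elems ] ∑[ g ← elems ] 𝟙[ A ] a * 𝟙[ B ] (g \\ a)
      ≡⟨ ∑-cong elems (λ a → ∑-distribˡ elems (𝟙[ A ] a) _) ⟩
    ∑[ a ← elems ] 𝟙[ A ] a * (∑[ g ← elems ] 𝟙[ B ] (g \\ a))
      ≡⟨ ∑-cong elems (λ a → cong (𝟙[ A ] a *_) (trans
           (∑-reindex (_\\ a) (a //_) (λ b → sym (//≡⇒≡\\ refl)) (λ g → ≡\\⇒//≡ refl) 𝟙[ B ])
           (sym (card≡∑ B)))) ⟩
    ∑[ a ← elems ] 𝟙[ A ] a * card G B
      ≡⟨ ∑-distribʳ elems (card G B) 𝟙[ A ] ⟩
    ∑ elems 𝟙[ A ] * card G B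
      ≡⟨ cong (_* card G B) (sym (card≡∑ A)) ⟩
    card G A * card G B ∎
    where open ≡-Reasoning

  BalancedPair : Subset G → Subset G → Set
  BalancedPair A B = Σ ℕ λ l → (l * order ≡ card G A * card G B) × ΔIs G A B l

  ΔIs⇒BalancedPair : ∀ {A B l} → ΔIs G A B l → BalancedPair A B
  ΔIs⇒BalancedPair {A} {B} {l} Δ≡l = l , l*order≡ , Δ≡l
    where
    l*order≡ : l * order ≡ card G A * card G B
    l*order≡ = begin
      l * order                      ≡⟨ *-comm l order ⟩
      order * l                      ≡⟨ sym (∑-const-cong elems Δ≡l) ⟩
      ∑[ g ← elems ] Δcount G A B g  ≡⟨ ∑-Δcount A B ⟩
      card G A * card G B            ∎
      where open ≡-Reasoning

  Δcount-congˡ : ∀ {A A′} B → SameSet G A A′ → ∀ g → Δcount G A B g ≡ Δcount G A′ B g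
  Δcount-congˡ {A} {A′} B A≈A′ g = begin
    Δcount G A B g                                ≡⟨ Δcount≡∑ A B g ⟩
    ∑[ a ← elems ] 𝟙[ A ] a * 𝟙[ B ] (g \\ a)
      ≡⟨ ∑-cong elems (λ a → cong (_* 𝟙[ B ] (g \\ a)) (𝟙[]-cong {A} {A′} A≈A′ a)) ⟩
    ∑[ a ← elems ] 𝟙[ A′ ] a * 𝟙[ B ] (g \\ a)  ≡⟨ sym (Δcount≡∑ A′ B g) ⟩
    Δcount G A′ B g                               ∎
    where open ≡-Reasoning

  Δcount-congʳ : ∀ A {B B′} → SameSet G B B′ → ∀ g → Δcount G A B g ≡ Δcount G A B′ g
  Δcount-congʳ A {B} {B′} B≈B′ g = begin
    Δcount G A B g                                ≡⟨ Δcount≡∑ A B g ⟩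
    ∑[ a ← elems ] 𝟙[ A ] a * 𝟙[ B ] (g \\ a)
      ≡⟨ ∑-cong elems (λ a → cong (𝟙[ A ] a *_) (𝟙[]-cong {B} {B′} B≈B′ (g \\ a))) ⟩
    ∑[ a ← elems ] 𝟙[ A ] a * 𝟙[ B′ ] (g \\ a)  ≡⟨ sym (Δcount≡∑ A B′ g) ⟩
    Δcount G A B′ g                               ∎
    where open ≡-Reasoning

  Δcount-ε : ∀ A B → Δcount G A B ε ≡ card G (_∩_ G A B)
  Δcount-ε A B = begin
    Δcount G A B ε                            ≡⟨ Δcount≡∑ A B ε ⟩
    ∑[ a ← elems ] 𝟙[ A ] a * 𝟙[ B ] (ε \\ a)
      ≡⟨ ∑-cong elems (λ a → cong (λ t → 𝟙[ A ] a * 𝟙[ B ] t) ε\\a≡a) ⟩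
    ∑[ a ← elems ] 𝟙[ A ] a * 𝟙[ B ] a
      ≡⟨ ∑-cong elems (λ a → sym (𝟙-× (mem? A a) (mem? B a))) ⟩
    ∑ elems 𝟙[ _∩_ G A B ]                    ≡⟨ sym (card≡∑ (_∩_ G A B)) ⟩
    card G (_∩_ G A B)                        ∎
    where
    open ≡-Reasoning
    ε\\a≡a : ∀ {a} → ε \\ a ≡ a
    ε\\a≡a {a} = trans (cong (_∙ a) ε⁻¹≈ε) (identityˡ a)

  card-leftCoset : ∀ c A → card G (leftCoset G c A) ≡ card G A
  card-leftCoset c A = begin
    card G (leftCoset G c A)       ≡⟨ card≡∑ (leftCoset G c A) ⟩
    ∑[ x ← elems ] 𝟙[ A ] (c \\ x)
      ≡⟨ ∑-reindex (c \\_) (c ∙_) (\\-leftDividesʳ c) (\\-leftDividesˡ c) 𝟙[ A ] ⟩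
    ∑ elems 𝟙[ A ]                 ≡⟨ sym (card≡∑ A) ⟩
    card G A                       ∎
    where open ≡-Reasoning

  Δcount-leftCosetˡ : ∀ c A B g → Δcount G (leftCoset G c A) B g ≡ Δcount G A B (c \\ g)
  Δcount-leftCosetˡ c A B g = begin
    Δcount G (leftCoset G c A) B g
      ≡⟨ Δcount≡∑ (leftCoset G c A) B g ⟩
    ∑[ a ← elems ] 𝟙[ A ] (c \\ a) * 𝟙[ B ] (g \\ a)
      ≡⟨ sym (∑-reindex (c ∙_) (c \\_) (\\-leftDividesˡ c) (\\-leftDividesʳ c) _) ⟩
    ∑[ a ← elems ] 𝟙[ A ] (c \\ (c ∙ a)) * 𝟙[ B ] (g \\ (c ∙ a))
      ≡⟨ ∑-cong elems (λ a → cong₂ (λ s t → 𝟙[ A ] s * 𝟙[ B ] t)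
                                   (\\-leftDividesʳ c a) (sym ([x\\y]\\z≡y\\[x∙z] c g a))) ⟩
    ∑[ a ← elems ] 𝟙[ A ] a * 𝟙[ B ] ((c \\ g) \\ a)
      ≡⟨ sym (Δcount≡∑ A B (c \\ g)) ⟩
    Δcount G A B (c \\ g) ∎
    where open ≡-Reasoning

  Δcount-leftCosetʳ : ∀ c A B g → Δcount G A (leftCoset G c B) g ≡ Δcount G A B (g ∙ c)
  Δcount-leftCosetʳ c A B g = begin
    Δcount G A (leftCoset G c B) g
      ≡⟨ Δcount≡∑ A (leftCoset G c B) g ⟩
    ∑[ a ← elems ] 𝟙[ A ] a * 𝟙[ B ] (c \\ (g \\ a))
      ≡⟨ ∑-cong elems (λ a → cong (λ t → 𝟙[ A ] a * 𝟙[ B ] t) (sym ([x∙y]\\z≡y\\[x\\z] g c a))) ⟩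
    ∑[ a ← elems ] 𝟙[ A ] a * 𝟙[ B ] ((g ∙ c) \\ a)
      ≡⟨ sym (Δcount≡∑ A B (g ∙ c)) ⟩
    Δcount G A B (g ∙ c) ∎
    where open ≡-Reasoning

  ΔIs-leftCosetˡ : ∀ {A B l} c → ΔIs G A B l → ΔIs G (leftCoset G c A) B l
  ΔIs-leftCosetˡ {A} {B} c Δ≡l g = trans (Δcount-leftCosetˡ c A B g) (Δ≡l (c \\ g))

  ΔIs-leftCosetʳ : ∀ {A B l} c → ΔIs G A B l → ΔIs G A (leftCoset G c B) l
  ΔIs-leftCosetʳ {A} {B} c Δ≡l g = trans (Δcount-leftCosetʳ c A B g) (Δ≡l (g ∙ c))

  leftCoset-member : ∀ {H x} → IsSubgroup G H → mem H x → SameSet G (leftCoset G x H) H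
  leftCoset-member {H} {x} H≤G x∈H y =
    (λ x\\y∈H → subst (mem H) (\\-leftDividesˡ x y) (∙∈ x∈H x\\y∈H)) ,
    (λ y∈H → ∙∈ (⁻¹∈ x∈H) y∈H)
    where open IsSubgroup H≤G

  leftCoset-overlap⇒SameSet : ∀ {H p q x} → IsSubgroup G H →
    mem H (p \\ x) → mem H (q \\ x) → SameSet G (leftCoset G p H) (leftCoset G q H)
  leftCoset-overlap⇒SameSet {H} {x = x} H≤G p\\x∈H q\\x∈H y =
    move p\\x∈H q\\x∈H , move q\\x∈H p\\x∈H
    where
    open IsSubgroup H≤G
    move : ∀ {p q} → mem H (p \\ x) → mem H (q \\ x) → mem H (p \\ y) → mem H (q \\ y)
    move {p} {q} p\\x∈H q\\x∈H p\\y∈H = subst (mem H) q\\x∙x\\y≡q\\y (∙∈ q\\x∈H x\\y∈H)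
      where
      x\\y∈H : mem H (x \\ y)
      x\\y∈H = subst (mem H)
        (trans ([x\\y]\\z≡y\\[x∙z] p x (p \\ y)) (cong (x \\_) (\\-leftDividesˡ p y)))
        (∙∈ (⁻¹∈ p\\x∈H) p\\y∈H)
      q\\x∙x\\y≡q\\y : (q \\ x) ∙ (x \\ y) ≡ q \\ y
      q\\x∙x\\y≡q\\y = trans (assoc (q ⁻¹) x (x \\ y)) (cong (q ⁻¹ ∙_) (\\-leftDividesˡ x y))

  ΔIs-subgroups : ∀ {H K} → IsSubgroup G H → IsSubgroup G K → ProductIsG G H K →
    ΔIs G H K (card G (_∩_ G H K))
  ΔIs-subgroups {H} {K} H≤G K≤G G≡HK g with G≡HK g
  ... | x , y , x∈H , y∈K , refl = begin
    Δcount G H K (x ∙ y)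
      ≡⟨ Δcount-congˡ {leftCoset G x H} {H} K (leftCoset-member H≤G x∈H) (x ∙ y) ⟨
    Δcount G (leftCoset G x H) K (x ∙ y) ≡⟨ Δcount-leftCosetˡ x H K (x ∙ y) ⟩
    Δcount G H K (x \\ (x ∙ y))          ≡⟨ cong (Δcount G H K) (\\-leftDividesʳ x y) ⟩
    Δcount G H K y                       ≡⟨ cong (Δcount G H K) (identityˡ y) ⟨
    Δcount G H K (ε ∙ y)                 ≡⟨ Δcount-leftCosetʳ y H K ε ⟨
    Δcount G H (leftCoset G y K) ε
      ≡⟨ Δcount-congʳ H {leftCoset G y K} {K} (leftCoset-member K≤G y∈K) ε ⟩
    Δcount G H K ε                       ≡⟨ Δcount-ε H K ⟩
    card G (_∩_ G H K)                   ∎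
    where open ≡-Reasoning

  record IsDisjointUnion {I : Set} (U : Subset G) (is : List I) (V : I → Subset G) : Set where
    field 𝟙-sum : ∀ x → 𝟙[ U ] x ≡ ∑[ i ← is ] 𝟙[ V i ] x

  module _ {I : Set} {U : Subset G} {is : List I} {V : I → Subset G}
           (U≡⨄V : IsDisjointUnion U is V) where
    open IsDisjointUnion U≡⨄V

    card-disjointUnion : ∀ {k} → (∀ i → card G (V i) ≡ k) → card G U ≡ length is * k
    card-disjointUnion {k} |Vi|≡k = begin
      card G U                              ≡⟨ card≡∑ U ⟩
      ∑ elems 𝟙[ U ]                        ≡⟨ ∑-cong elems 𝟙-sum ⟩
      ∑[ x ← elems ] ∑[ i ← is ] 𝟙[ V i ] x ≡⟨ ∑-comm elems is _ ⟩
      ∑[ i ← is ] ∑ elems 𝟙[ V i ]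
        ≡⟨ ∑-const-cong is (λ i → trans (sym (card≡∑ (V i))) (|Vi|≡k i)) ⟩
      length is * k                         ∎
      where open ≡-Reasoning

    ΔIs-disjointUnionˡ : ∀ {B l} → (∀ i → ΔIs G (V i) B l) → ΔIs G U B (length is * l)
    ΔIs-disjointUnionˡ {B} {l} Δ≡l g = begin
      Δcount G U B g
        ≡⟨ Δcount≡∑ U B g ⟩
      ∑[ a ← elems ] 𝟙[ U ] a * 𝟙[ B ] (g \\ a)
        ≡⟨ ∑-cong elems (λ a → trans (cong (_* 𝟙[ B ] (g \\ a)) (𝟙-sum a))
                                      (sym (∑-distribʳ is (𝟙[ B ] (g \\ a)) _))) ⟩
      ∑[ a ← elems ] ∑[ i ← is ] 𝟙[ V i ] a * 𝟙[ B ] (g \\ a)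
        ≡⟨ ∑-comm elems is _ ⟩
      ∑[ i ← is ] ∑[ a ← elems ] 𝟙[ V i ] a * 𝟙[ B ] (g \\ a)
        ≡⟨ ∑-const-cong is (λ i → trans (sym (Δcount≡∑ (V i) B g)) (Δ≡l i g)) ⟩
      length is * l ∎
      where open ≡-Reasoning

    ΔIs-disjointUnionʳ : ∀ {A l} → (∀ i → ΔIs G A (V i) l) → ΔIs G A U (length is * l)
    ΔIs-disjointUnionʳ {A} {l} Δ≡l g = begin
      Δcount G A U g
        ≡⟨ Δcount≡∑ A U g ⟩
      ∑[ a ← elems ] 𝟙[ A ] a * 𝟙[ U ] (g \\ a)
        ≡⟨ ∑-cong elems (λ a → trans (cong (𝟙[ A ] a *_) (𝟙-sum (g \\ a)))
                                      (sym (∑-distribˡ is (𝟙[ A ] a) _))) ⟩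
      ∑[ a ← elems ] ∑[ i ← is ] 𝟙[ A ] a * 𝟙[ V i ] (g \\ a)
        ≡⟨ ∑-comm elems is _ ⟩
      ∑[ i ← is ] ∑[ a ← elems ] 𝟙[ A ] a * 𝟙[ V i ] (g \\ a)
        ≡⟨ ∑-const-cong is (λ i → trans (sym (Δcount≡∑ A (V i) g)) (Δ≡l i g)) ⟩
      length is * l ∎
      where open ≡-Reasoning

  module _ {H : Subset G} (H≤G : IsSubgroup G H) {μ : ℕ} {r : Fin μ → Carrier}
           (distinct : DistinctCosets G μ r H) where

    unionCosets-disjoint :
      IsDisjointUnion (unionCosets G μ r H) (allFin μ) (λ a → leftCoset G (r a) H)
    unionCosets-disjoint = record { 𝟙-sum = λ x →
      𝟙-∃! (λ a → mem? (leftCoset G (r a) H) x) same-coset (mem? (unionCosets G μ r H) x) }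
      where
      open Enumeration _≟ᶠ_ ∈-allFin (allFin⁺ μ) using (𝟙-∃!)
      same-coset : ∀ {x a b} → mem H (r a \\ x) → mem H (r b \\ x) → a ≡ b
      same-coset {x} {a} {b} x∈raH x∈rbH with a ≟ᶠ b
      ... | yes a≡b = a≡b
      ... | no a≢b  = ⊥-elim (distinct a b a≢b (leftCoset-overlap⇒SameSet H≤G x∈raH x∈rbH))

    length-allFin : length (allFin μ) ≡ μ
    length-allFin = length-tabulate (λ a → a)

    card-unionCosets : card G (unionCosets G μ r H) ≡ μ * card G H
    card-unionCosets = subst (λ n → card G (unionCosets G μ r H) ≡ n * card G H) length-allFin
      (card-disjointUnion unionCosets-disjoint (λ a → card-leftCoset (r a) H))

    ΔIs-unionCosetsˡ : ∀ {B l} → ΔIs G H B l → ΔIs G (unionCosets G μ r H) B (μ * l)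
    ΔIs-unionCosetsˡ {B} {l} Δ≡l = subst (λ n → ΔIs G (unionCosets G μ r H) B (n * l)) length-allFin
      (ΔIs-disjointUnionˡ unionCosets-disjoint (λ a → ΔIs-leftCosetˡ {H} {B} (r a) Δ≡l))

    ΔIs-unionCosetsʳ : ∀ {A l} → ΔIs G A H l → ΔIs G A (unionCosets G μ r H) (μ * l)
    ΔIs-unionCosetsʳ {A} {l} Δ≡l = subst (λ n → ΔIs G A (unionCosets G μ r H) (n * l)) length-allFin
      (ΔIs-disjointUnionʳ unionCosets-disjoint {A} (λ a → ΔIs-leftCosetʳ {A} {H} (r a) Δ≡l))

  replaceAt-GPSEDF : ∀ {m} {A : Fin m → Subset G} {i U} → IsGPSEDF G m A →
    (∀ j → j ≢ i → BalancedPair U (A j) × BalancedPair (A j) U) →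
    IsGPSEDF G m (replaceAt G A i U)
  replaceAt-GPSEDF {i = i} A-GPSEDF U-balanced k l k≢l with k ≟ᶠ i | l ≟ᶠ i
  ... | yes refl | yes refl = ⊥-elim (k≢l refl)
  ... | yes refl | no l≢i   = proj₁ (U-balanced l l≢i)
  ... | no _     | yes refl = proj₂ (U-balanced k k≢l)
  ... | no _     | no _     = A-GPSEDF k l k≢l

theorem4p3 : (G : FinGroup) (m : ℕ) (H : Fin m → Subset G) →
    (∀ i → IsSubgroup G (H i)) →
    (∀ i j → i ≢ j → ¬ SameSet G (H i) (H j)) →
    (∀ i j → i ≢ j → ProductIsG G (H i) (H j)) →
    (IsGPSEDF G m H
      × (∀ i j → i ≢ j → ΔIs G (H i) (H j) (card G (_∩_ G (H i) (H j)))))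
    × (∀ i (μ : ℕ) (r : Fin μ → FinGroup.Carrier G) →
         DistinctCosets G μ r (H i) →
         (card G (unionCosets G μ r (H i)) ≡ μ * card G (H i))
         × IsGPSEDF G m (replaceAt G H i (unionCosets G μ r (H i))))
theorem4p3 G m H H≤G _ G≡HᵢHⱼ = (GPSEDF , Δ≡∩) , replaced
  where
  Δ≡∩ : ∀ i j → i ≢ j → ΔIs G (H i) (H j) (card G (_∩_ G (H i) (H j)))
  Δ≡∩ i j i≢j = ΔIs-subgroups G (H≤G i) (H≤G j) (G≡HᵢHⱼ i j i≢j)

  GPSEDF : IsGPSEDF G m H
  GPSEDF i j i≢j = ΔIs⇒BalancedPair G (Δ≡∩ i j i≢j)

  replaced : ∀ i (μ : ℕ) (r : Fin μ → FinGroup.Carrier G) → DistinctCosets G μ r (H i) →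
    (card G (unionCosets G μ r (H i)) ≡ μ * card G (H i))
    × IsGPSEDF G m (replaceAt G H i (unionCosets G μ r (H i)))
  replaced i μ r distinct =
    card-unionCosets G (H≤G i) distinct ,
    replaceAt-GPSEDF G GPSEDF (λ j j≢i →
      ΔIs⇒BalancedPair G (ΔIs-unionCosetsˡ G (H≤G i) distinct (Δ≡∩ i j (≢-sym j≢i))) ,
      ΔIs⇒BalancedPair G (ΔIs-unionCosetsʳ G (H≤G i) distinct {H j} (Δ≡∩ j i j≢i)))
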